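{- For every $p\ge 0$, every permutation in $\mathcal{B}_p$ has length at most $2(p+1)$ and at least $p+2$. Consequently $\mathcal{B}_p$ is a finite set.
   Context: A right-jump transforms $\sigma=\sigma_1\cdots\sigma_n$ into $\sigma_1\cdots\sigma_{i-1}\sigma_{i+1}\cdots\sigma_j\,\sigma_i\,\sigma_{j+1}\cdots\sigma_n$ for some $1\le i<j\le n$. A permutation $\pi$ is a pattern of $\sigma$ ($\pi\prec\sigma$) if some subsequence of $\sigma$ is order-isomorphic to $\pi$. $\mathcal{C}_p$ is the set of all permutations (of any length $n$) obtainable from the identity of length $n$ by at most $p$ right-jumps. $\mathcal{B}_p$ is the set of permutations $\sigma\notin\mathcal{C}_p$ such that every pattern $\pi\prec\sigma$ with $\pi\neq\sigma$ lies in $\mathcal{C}_p$. -}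

module Defs where

open import Data.Nat using (ℕ; zero; suc; _+_; _*_; _∸_; _≤_; _<_)
open import Data.List using (List; []; _∷_; _++_; take; drop; length; upTo; lookup)
open import Data.List.Relation.Binary.Permutation.Propositional using (_↭_)
open import Data.List.Relation.Binary.Sublist.Propositional using (_⊆_)
open import Data.Fin using (Fin; cast)
open import Data.Product using (Σ; ∃; _×_)
open import Function.Bundles using (_⇔_)
open import Relation.Binary.PropositionalEquality using (_≡_)
open import Relation.Nullary using (¬_)

-- Permutations of length n are lists that are rearrangements of 0,1,…,n-1
-- (values 0-based; only the relative order matters for everything below).
IsPerm : List ℕ → Set
IsPerm σ = σ ↭ upTo (length σ)

-- Right-jump with 0-based positions i < j < length σ:
-- σ₀…σ_{i-1} σ_{i+1}…σ_j σ_i σ_{j+1}…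
rightJump : ℕ → ℕ → List ℕ → List ℕ
rightJump i j σ with drop i σ
... | []       = σ
... | x ∷ rest = take i σ ++ (take (j ∸ i) rest ++ (x ∷ drop (j ∸ i) rest))

data Jumps : ℕ → List ℕ → Set where
  start : (n : ℕ) → Jumps 0 (upTo n)
  step  : ∀ {k σ} (i j : ℕ) → Jumps k σ → i < j → j < length σ →
          Jumps (suc k) (rightJump i j σ)

InC : ℕ → List ℕ → Set
InC p σ = IsPerm σ × (∃ λ k → k ≤ p × Jumps k σ)

OrderIso : List ℕ → List ℕ → Set
OrderIso π τ = Σ (length π ≡ length τ) λ eq →
  ∀ (a b : Fin (length π)) →
    (lookup π a < lookup π b) ⇔ (lookup τ (cast eq a) < lookup τ (cast eq b))

Pattern : List ℕ → List ℕ → Set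
Pattern π σ = IsPerm π × (∃ λ τ → τ ⊆ σ × OrderIso π τ)

InB : ℕ → List ℕ → Set
InB p σ = IsPerm σ × ¬ InC p σ × (∀ π → Pattern π σ → ¬ (π ≡ σ) → InC p π)

-- Let r(σ) be the number of left-to-right maxima of σ. A right-jump destroys at most one
-- left-to-right maximum, and conversely σ is reached from the identity by n − r(σ) jumps
-- (induct on the last entry), so σ ∈ C_p iff n ≤ p + r(σ). For σ ∈ B_p this gives
-- n > p + r(σ), while deleting the last entry leaves a proper pattern in C_p, so
-- n = p + r(σ) + 1 ≥ p + 2. If moreover n > 2(p + 1), more than half of the entries are
-- left-to-right maxima, so one of them is immediately followed by another; deleting it
-- lowers both n and r(σ) by one, leaving a proper pattern outside C_p.
module Submission where

open import Data.Empty using (⊥-elim)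
open import Data.Fin using (Fin; cast; zero; suc)
open import Data.List using (List; []; _∷_; _++_; _∷ʳ_; [_]; take; drop; length; upTo; applyUpTo; map; lookup; InitLast; initLast; _∷ʳ′_)
open import Data.List.Membership.Propositional using (_∈_)
open import Data.List.Membership.Propositional.Properties using (∈-lookup; ∈-++⁺ʳ; ∈-++⁻)
open import Data.List.Properties using (length-map; map-++; length-++; length-upTo; upTo-∷ʳ; ++-identityʳ; map-∘; map-id-local; length-++-sucʳ)
open import Data.List.Relation.Binary.Permutation.Propositional using (_↭_; ↭-sym; ↭-trans; ↭-reflexive)
open import Data.List.Relation.Binary.Permutation.Propositional.Properties using (drop-mid; map⁺; ∈-resp-↭; ↭-length; ↭-empty-inv)
open import Data.List.Relation.Binary.Sublist.Propositional using (⊆-refl)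
open import Data.List.Relation.Binary.Sublist.Propositional.Properties using (++⁺; ++⁺ˡ)
open import Data.List.Relation.Unary.All as All using (All; []; _∷_)
open import Data.List.Relation.Unary.Any using (here; there)
open import Data.Nat using (ℕ; zero; suc; _+_; _*_; _∸_; _≤_; _<_; z≤n; s≤s; z<s; s<s; pred; _≤?_; _<?_; _≟_; >-nonZero)
open import Data.Nat.Properties
open import Data.Product using (_×_; _,_; proj₁; proj₂; ∃-syntax)
open import Data.Sum using (inj₁; inj₂)
open import Function.Base using (_∘_)
open import Function.Bundles using (_⇔_; mk⇔; Equivalence)
open import Function.Properties.Equivalence using () renaming (sym to ⇔-sym)
open import Relation.Binary.Core using (_Preserves_⟶_)
open import Relation.Binary.Definitions using (tri<; tri≈; tri>)
open import Relation.Binary.PropositionalEquality hiding ([_])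
open import Relation.Nullary using (¬_; yes; no)

open import Defs

range : ℕ → ℕ → List ℕ
range s zero    = []
range s (suc n) = s ∷ range (suc s) n

applyUpTo≡range : ∀ {f : ℕ → ℕ} s n → (∀ i → f i ≡ s + i) → applyUpTo f n ≡ range s n
applyUpTo≡range s zero    f≗s+ = refl
applyUpTo≡range s (suc n) f≗s+ = cong₂ _∷_
  (trans (f≗s+ 0) (+-identityʳ s))
  (applyUpTo≡range (suc s) n (λ i → trans (f≗s+ (suc i)) (+-suc s i)))

upTo≡range : ∀ n → upTo n ≡ range 0 n
upTo≡range n = applyUpTo≡range 0 n (λ i → refl)

length-range : ∀ s n → length (range s n) ≡ n
length-range s zero    = refl
length-range s (suc n) = cong suc (length-range (suc s) n)

range-++ : ∀ s a b → range s (a + b) ≡ range s a ++ range (s + a) b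
range-++ s zero    b rewrite +-identityʳ s = refl
range-++ s (suc a) b rewrite +-suc s a = cong (s ∷_) (range-++ (suc s) a b)

∈-range⁻ : ∀ {y} s n → y ∈ range s n → s ≤ y × y < s + n
∈-range⁻ s (suc n) (here refl) = ≤-refl , subst (s <_) (sym (+-suc s n)) (s≤s (m≤m+n s n))
∈-range⁻ {y} s (suc n) (there y∈) with ∈-range⁻ (suc s) n y∈
... | s<y , y<1+s+n = <⇒≤ s<y , subst (y <_) (sym (+-suc s n)) y<1+s+n

∈-range⁺ : ∀ {y} s n → s ≤ y → y < s + n → y ∈ range s n
∈-range⁺ s zero    s≤y y<s+0 = ⊥-elim (<⇒≱ y<s+0 (subst (_≤ _) (sym (+-identityʳ s)) s≤y))
∈-range⁺ {y} s (suc n) s≤y y<s+n with s ≟ y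
... | yes refl = here refl
... | no  s≢y  = there (∈-range⁺ (suc s) n (≤∧≢⇒< s≤y s≢y) (subst (y <_) (+-suc s n) y<s+n))

map-range : ∀ (f : ℕ → ℕ) s s′ n → (∀ i → i < n → f (s + i) ≡ s′ + i) → map f (range s n) ≡ range s′ n
map-range f s s′ zero    f-shifts = refl
map-range f s s′ (suc n) f-shifts = cong₂ _∷_
  (trans (cong f (sym (+-identityʳ s))) (trans (f-shifts 0 z<s) (+-identityʳ s′)))
  (map-range f (suc s) (suc s′) n λ i i<n →
    trans (cong f (sym (+-suc s i))) (trans (f-shifts (suc i) (s<s i<n)) (+-suc s′ i)))

-- records t xs counts the left-to-right maxima of xs that are at least t.
records : ℕ → List ℕ → ℕ
records t []       = 0
records t (x ∷ xs) with t ≤? x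
... | yes _ = suc (records (suc x) xs)
... | no  _ = records t xs

records-≤ : ∀ {t x} xs → t ≤ x → records t (x ∷ xs) ≡ suc (records (suc x) xs)
records-≤ {t} {x} xs t≤x with t ≤? x
... | yes _   = refl
... | no  t≰x = ⊥-elim (t≰x t≤x)

records-> : ∀ {t x} xs → x < t → records t (x ∷ xs) ≡ records t xs
records-> {t} {x} xs x<t with t ≤? x
... | yes t≤x = ⊥-elim (<⇒≱ x<t t≤x)
... | no  _   = refl

records-range : ∀ {t} s n → t ≤ s → records t (range s n) ≡ n
records-range s zero    t≤s = refl
records-range s (suc n) t≤s rewrite records-≤ (range (suc s) n) t≤s =
  cong suc (records-range (suc s) n ≤-refl)

records-++-≤ : ∀ t xs ys → records t xs ≤ records t (xs ++ ys)
records-++-≤ t []       ys = z≤n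
records-++-≤ t (x ∷ xs) ys with t ≤? x
... | yes _ = s≤s (records-++-≤ (suc x) xs ys)
... | no  _ = records-++-≤ t xs ys

records-∷ʳ-≤ : ∀ t xs y → records t (xs ∷ʳ y) ≤ suc (records t xs)
records-∷ʳ-≤ t []       y with t ≤? y
... | yes _ = ≤-refl
... | no  _ = z≤n
records-∷ʳ-≤ t (x ∷ xs) y with t ≤? x
... | yes _ = s≤s (records-∷ʳ-≤ (suc x) xs y)
... | no  _ = records-∷ʳ-≤ t xs y

records-∷ʳ-> : ∀ t xs {y} → y < t → records t (xs ∷ʳ y) ≡ records t xs
records-∷ʳ-> t []       y<t = records-> [] y<t
records-∷ʳ-> t (x ∷ xs) y<t with t ≤? x
... | yes t≤x = cong suc (records-∷ʳ-> (suc x) xs (<-≤-trans y<t (m≤n⇒m≤1+n t≤x)))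
... | no  _   = records-∷ʳ-> t xs y<t

records-∷ʳ-dominated : ∀ t xs {x y} → x ∈ xs → y ≤ x → records t (xs ∷ʳ y) ≡ records t xs
records-∷ʳ-dominated t (x ∷ xs) (here refl) y≤x with t ≤? x
... | yes _   = cong suc (records-∷ʳ-> (suc x) xs (s≤s y≤x))
... | no  t≰x = records-∷ʳ-> t xs (≤-<-trans y≤x (≰⇒> t≰x))
records-∷ʳ-dominated t (x′ ∷ xs) (there x∈) y≤x with t ≤? x′
... | yes _ = cong suc (records-∷ʳ-dominated (suc x′) xs x∈ y≤x)
... | no  _ = records-∷ʳ-dominated t xs x∈ y≤x

records-pos : ∀ xs → 0 < length xs → 0 < records 0 xs
records-pos (x ∷ xs) _ rewrite records-≤ {0} {x} xs z≤n = z<s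

slide : ℕ → ℕ → List ℕ → List ℕ
slide x zero    ys       = x ∷ ys
slide x (suc j) []       = [ x ]
slide x (suc j) (y ∷ ys) = y ∷ slide x j ys

jump : ℕ → ℕ → List ℕ → List ℕ
jump i       j []      = []
jump zero    j (x ∷ σ) = slide x j σ
jump (suc i) j (y ∷ σ) = y ∷ jump i (pred j) σ

slide≡take++drop : ∀ x j ys → slide x j ys ≡ take j ys ++ x ∷ drop j ys
slide≡take++drop x zero    ys       = refl
slide≡take++drop x (suc j) []       = refl
slide≡take++drop x (suc j) (y ∷ ys) = cong (y ∷_) (slide≡take++drop x j ys)

rightJump≡jump : ∀ i j σ → rightJump i j σ ≡ jump i j σ
rightJump≡jump zero    j []      = refl
rightJump≡jump (suc i) j []      = refl
rightJump≡jump zero    j (x ∷ σ) = sym (slide≡take++drop x j σ)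
rightJump≡jump (suc i) j (y ∷ σ) =
  trans (rightJump-∷ i j y σ) (cong (y ∷_) (rightJump≡jump i (pred j) σ))
  where
  rightJump-∷ : ∀ i j y σ → rightJump (suc i) j (y ∷ σ) ≡ y ∷ rightJump i (pred j) σ
  rightJump-∷ i j y σ with drop i σ
  ... | []    = refl
  ... | _ ∷ _ rewrite ∸-+-assoc j 1 i = refl

length-slide : ∀ x j ys → length (slide x j ys) ≡ suc (length ys)
length-slide x zero    ys       = refl
length-slide x (suc j) []       = refl
length-slide x (suc j) (y ∷ ys) = cong suc (length-slide x j ys)

length-jump : ∀ i j σ → length (jump i j σ) ≡ length σ
length-jump i       j []      = refl
length-jump zero    j (x ∷ σ) = length-slide x j σ
length-jump (suc i) j (y ∷ σ) = cong suc (length-jump i (pred j) σ)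

records-slide-> : ∀ {t x} j ys → x < t → records t (slide x j ys) ≡ records t ys
records-slide-> zero    ys       x<t = records-> ys x<t
records-slide-> (suc j) []       x<t = records-> [] x<t
records-slide-> {t} (suc j) (y ∷ ys) x<t with t ≤? y
... | yes t≤y = cong suc (records-slide-> j ys (<-≤-trans x<t (m≤n⇒m≤1+n t≤y)))
... | no  _   = records-slide-> j ys x<t

records-slide-≥ : ∀ {t x} j ys → t ≤ suc x → records (suc x) ys ≤ records t (slide x j ys)
records-slide-≥ {t} {x} zero ys t≤1+x with t ≤? x
... | yes _   = n≤1+n _
... | no  t≰x rewrite ≤-antisym t≤1+x (≰⇒> t≰x) = ≤-refl
records-slide-≥ (suc j) [] t≤1+x = z≤n
records-slide-≥ {t} {x} (suc j) (y ∷ ys) t≤1+x with suc x ≤? y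
... | yes x<y rewrite records-≤ (slide x j ys) (≤-trans t≤1+x x<y) =
  s≤s (≤-reflexive (sym (records-slide-> j ys (s≤s (<⇒≤ x<y)))))
... | no  x≮y with t ≤? y
...   | yes _ = m≤n⇒m≤1+n (records-slide-≥ j ys (s≤s (≤-pred (≰⇒> x≮y))))
...   | no  _ = records-slide-≥ j ys t≤1+x

records-slide : ∀ t x j ys → records t (x ∷ ys) ≤ suc (records t (slide x j ys))
records-slide t x j ys with t ≤? x
... | yes t≤x = s≤s (records-slide-≥ j ys (m≤n⇒m≤1+n t≤x))
... | no  t≰x rewrite records-slide-> j ys (≰⇒> t≰x) = n≤1+n _

records-jump : ∀ t i j σ → records t σ ≤ suc (records t (jump i j σ))
records-jump t i       j []      = z≤n
records-jump t zero    j (x ∷ σ) = records-slide t x j σ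
records-jump t (suc i) j (y ∷ σ) with t ≤? y
... | yes _ = s≤s (records-jump (suc y) i (pred j) σ)
... | no  _ = records-jump t i (pred j) σ

length≤jumps+records : ∀ {k σ} → Jumps k σ → length σ ≤ k + records 0 σ
length≤jumps+records (start n) rewrite upTo≡range n | length-range 0 n | records-range 0 n z≤n = ≤-refl
length≤jumps+records {suc k} (step {σ = σ} i j J _ _) rewrite rightJump≡jump i j σ | length-jump i j σ =
  begin
    length σ                             ≤⟨ length≤jumps+records J ⟩
    k + records 0 σ                      ≤⟨ +-monoʳ-≤ k (records-jump 0 i j σ) ⟩
    k + suc (records 0 (jump i j σ))     ≡⟨ +-suc k _ ⟩
    suc k + records 0 (jump i j σ)       ∎
  where open ≤-Reasoning

openGap : ℕ → ℕ → ℕ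
openGap z y with y <? z
... | yes _ = y
... | no  _ = suc y

closeGap : ℕ → ℕ → ℕ
closeGap z y with z <? y
... | yes _ = pred y
... | no  _ = y

openGap-< : ∀ {z y} → y < z → openGap z y ≡ y
openGap-< {z} {y} y<z with y <? z
... | yes _   = refl
... | no  y≮z = ⊥-elim (y≮z y<z)

openGap-≥ : ∀ {z y} → z ≤ y → openGap z y ≡ suc y
openGap-≥ {z} {y} z≤y with y <? z
... | yes y<z = ⊥-elim (<⇒≱ y<z z≤y)
... | no  _   = refl

closeGap-> : ∀ {z y} → z < y → closeGap z y ≡ pred y
closeGap-> {z} {y} z<y with z <? y
... | yes _   = refl
... | no  z≮y = ⊥-elim (z≮y z<y)

closeGap-≤ : ∀ {z y} → y ≤ z → closeGap z y ≡ y
closeGap-≤ {z} {y} y≤z with z <? y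
... | yes z<y = ⊥-elim (<⇒≱ z<y y≤z)
... | no  _   = refl

openGap-closeGap : ∀ {z y} → y ≢ z → openGap z (closeGap z y) ≡ y
openGap-closeGap {z} {y} y≢z with <-cmp z y
... | tri< z<y _ _ rewrite closeGap-> z<y =
  trans (openGap-≥ (<⇒≤pred z<y)) (suc-pred y {{>-nonZero (≤-<-trans z≤n z<y)}})
... | tri≈ _ z≡y _ = ⊥-elim (y≢z (sym z≡y))
... | tri> _ _ y<z rewrite closeGap-≤ (<⇒≤ y<z) = openGap-< y<z

openGap-mono-< : ∀ z → openGap z Preserves _<_ ⟶ _<_
openGap-mono-< z {x} {y} x<y with x <? z | y <? z
... | yes _   | yes _   = x<y
... | yes _   | no  _   = m<n⇒m<1+n x<y
... | no  x≮z | yes y<z = ⊥-elim (x≮z (<-trans x<y y<z))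
... | no  _   | no  _   = s<s x<y

strictMono⇒reflects-< : ∀ {f : ℕ → ℕ} → f Preserves _<_ ⟶ _<_ → ∀ {x y} → f x < f y → x < y
strictMono⇒reflects-< f-mono {x} {y} fx<fy with <-cmp x y
... | tri< x<y _ _ = x<y
... | tri≈ _ refl _ = ⊥-elim (<-irrefl refl fx<fy)
... | tri> _ _ y<x = ⊥-elim (<-asym fx<fy (f-mono y<x))

OrderEmbeddingOn : (ℕ → Set) → (ℕ → ℕ) → Set
OrderEmbeddingOn P f = ∀ {x y} → P x → P y → (x < y ⇔ f x < f y)

closeGap-orderEmbedding : ∀ z → OrderEmbeddingOn (_≢ z) (closeGap z)
closeGap-orderEmbedding z {x} {y} x≢z y≢z = mk⇔
  (λ x<y → strictMono⇒reflects-< (openGap-mono-< z)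
              (subst₂ _<_ (sym (openGap-closeGap x≢z)) (sym (openGap-closeGap y≢z)) x<y))
  (λ gx<gy → subst₂ _<_ (openGap-closeGap x≢z) (openGap-closeGap y≢z) (openGap-mono-< z gx<gy))

records-map-above : ∀ {P f} → OrderEmbeddingOn P f → ∀ {m} xs → P m → All P xs →
  records (suc m) xs ≡ records (suc (f m)) (map f xs)
records-map-above emb []       Pm []          = refl
records-map-above {f = f} emb {m} (x ∷ xs) Pm (Px ∷ Pxs) with suc m ≤? x | suc (f m) ≤? f x
... | yes _   | yes _     = cong suc (records-map-above emb xs Px Pxs)
... | yes m<x | no  fm≮fx = ⊥-elim (fm≮fx (Equivalence.to (emb Pm Px) m<x))
... | no  m≮x | yes fm<fx = ⊥-elim (m≮x (Equivalence.from (emb Pm Px) fm<fx))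
... | no  _   | no  _     = records-map-above emb xs Pm Pxs

records-map : ∀ {P f} → OrderEmbeddingOn P f → ∀ xs → All P xs → records 0 xs ≡ records 0 (map f xs)
records-map emb []       []          = refl
records-map {f = f} emb (x ∷ xs) (Px ∷ Pxs)
  rewrite records-≤ {0} {x} xs z≤n | records-≤ {0} {f x} (map f xs) z≤n =
  cong suc (records-map-above emb xs Px Pxs)

lookup-map : ∀ (f : ℕ → ℕ) xs (a : Fin (length (map f xs))) →
  lookup (map f xs) a ≡ f (lookup xs (cast (length-map f xs) a))
lookup-map f (x ∷ xs) zero    = refl
lookup-map f (x ∷ xs) (suc a) = lookup-map f xs a

map-orderIso : ∀ {P f} → OrderEmbeddingOn P f → ∀ {xs} → All P xs → OrderIso (map f xs) xs
map-orderIso {f = f} emb {xs} Pxs = length-map f xs , λ a b →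
  let a′ = cast (length-map f xs) a
      b′ = cast (length-map f xs) b
  in subst₂ (λ u v → u < v ⇔ lookup xs a′ < lookup xs b′)
       (sym (lookup-map f xs a)) (sym (lookup-map f xs b))
       (⇔-sym (emb (All.lookup Pxs (∈-lookup a′)) (All.lookup Pxs (∈-lookup b′))))

standardize-deletion : ∀ {m} A v B → A ++ v ∷ B ↭ range 0 (suc m) →
  v ≤ m × map (closeGap v) (A ++ B) ↭ range 0 m × All (_≢ v) (A ++ B)
standardize-deletion {m} A v B perm =
  v≤m , ↭-trans (map⁺ (closeGap v) rest↭) (↭-reflexive closed) , All.tabulate ≢v
  where
  v≤m : v ≤ m
  v≤m = ≤-pred (proj₂ (∈-range⁻ 0 (suc m) (∈-resp-↭ perm (∈-++⁺ʳ A (here refl)))))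
  m≡v+[m∸v] : m ≡ v + (m ∸ v)
  m≡v+[m∸v] = sym (m+[n∸m]≡n v≤m)
  split : range 0 (suc m) ≡ range 0 v ++ v ∷ range (suc v) (m ∸ v)
  split = trans (cong (range 0) (trans (cong suc m≡v+[m∸v]) (sym (+-suc v (m ∸ v)))))
                (range-++ 0 v (suc (m ∸ v)))
  rest↭ : A ++ B ↭ range 0 v ++ range (suc v) (m ∸ v)
  rest↭ = drop-mid A (range 0 v) (↭-trans perm (↭-reflexive split))
  ≢v : ∀ {y} → y ∈ A ++ B → y ≢ v
  ≢v y∈ with ∈-++⁻ (range 0 v) (∈-resp-↭ rest↭ y∈)
  ... | inj₁ y∈below = λ y≡v → <-irrefl y≡v (proj₂ (∈-range⁻ 0 v y∈below))
  ... | inj₂ y∈above = λ y≡v → <-irrefl (sym y≡v) (proj₁ (∈-range⁻ (suc v) (m ∸ v) y∈above))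
  closed : map (closeGap v) (range 0 v ++ range (suc v) (m ∸ v)) ≡ range 0 m
  closed = begin
    map (closeGap v) (range 0 v ++ range (suc v) (m ∸ v))
      ≡⟨ map-++ (closeGap v) (range 0 v) _ ⟩
    map (closeGap v) (range 0 v) ++ map (closeGap v) (range (suc v) (m ∸ v))
      ≡⟨ cong₂ _++_ (map-range (closeGap v) 0 0 v λ i i<v → closeGap-≤ (<⇒≤ i<v))
                    (map-range (closeGap v) (suc v) v (m ∸ v) λ i _ → closeGap-> (s≤s (m≤m+n v i))) ⟩
    range 0 v ++ range v (m ∸ v)
      ≡⟨ sym (range-++ 0 v (m ∸ v)) ⟩
    range 0 (v + (m ∸ v))
      ≡⟨ cong (range 0) (sym m≡v+[m∸v]) ⟩
    range 0 m ∎
    where open ≡-Reasoning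

slide-map : ∀ (f : ℕ → ℕ) x j ys → slide (f x) j (map f ys) ≡ map f (slide x j ys)
slide-map f x zero    ys       = refl
slide-map f x (suc j) []       = refl
slide-map f x (suc j) (y ∷ ys) = cong (f y ∷_) (slide-map f x j ys)

jump-map : ∀ (f : ℕ → ℕ) i j σ → jump i j (map f σ) ≡ map f (jump i j σ)
jump-map f i       j []      = refl
jump-map f zero    j (x ∷ σ) = slide-map f x j σ
jump-map f (suc i) j (y ∷ σ) = cong (f y ∷_) (jump-map f i (pred j) σ)

slide-∷ʳ : ∀ x j ys z → j ≤ length ys → slide x j (ys ∷ʳ z) ≡ slide x j ys ∷ʳ z
slide-∷ʳ x zero    ys       z _         = refl
slide-∷ʳ x (suc j) (y ∷ ys) z (s≤s j≤) = cong (y ∷_) (slide-∷ʳ x j ys z j≤)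

jump-∷ʳ : ∀ i j σ z → i < j → j < length σ → jump i j (σ ∷ʳ z) ≡ jump i j σ ∷ʳ z
jump-∷ʳ zero    j       (x ∷ σ) z _          (s≤s j≤) = slide-∷ʳ x j σ z j≤
jump-∷ʳ (suc i) (suc j) (y ∷ σ) z (s≤s i<j) (s≤s j<) = cong (y ∷_) (jump-∷ʳ i j σ z i<j j<)

slide-past-all : ∀ x ys → slide x (length ys) ys ≡ ys ∷ʳ x
slide-past-all x []       = refl
slide-past-all x (y ∷ ys) = cong (y ∷_) (slide-past-all x ys)

map-openGap-range : ∀ {z} s n → z ≤ s → map (openGap z) (range s n) ≡ range (suc s) n
map-openGap-range s n z≤s = map-range _ s (suc s) n λ i _ → openGap-≥ (≤-trans z≤s (m≤m+n s i))

jump-range : ∀ s z m → z ≤ m →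
  jump z m (range s (suc m)) ≡ map (openGap (s + z)) (range s m) ∷ʳ (s + z)
jump-range s zero m _ rewrite +-identityʳ s =
  begin
    slide s m (range (suc s) m)
      ≡⟨ cong (λ n → slide s n (range (suc s) m)) (sym (length-range (suc s) m)) ⟩
    slide s (length (range (suc s) m)) (range (suc s) m)
      ≡⟨ slide-past-all s (range (suc s) m) ⟩
    range (suc s) m ∷ʳ s
      ≡⟨ cong (_∷ʳ s) (sym (map-openGap-range s m ≤-refl)) ⟩
    map (openGap s) (range s m) ∷ʳ s ∎
  where open ≡-Reasoning
jump-range s (suc z) (suc m) (s≤s z≤m)
  rewrite +-suc s z | openGap-< {suc (s + z)} {s} (s≤s (m≤m+n s z)) =
  cong (s ∷_) (jump-range (suc s) z m z≤m)

-- Jumps act on positions only, and never reach an appended last entry.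
Jumps-lift : ∀ (f : ℕ → ℕ) z m {k₀} → Jumps k₀ (map f (upTo m) ∷ʳ z) →
  ∀ {k ρ} → Jumps k ρ → length ρ ≡ m → Jumps (k₀ + k) (map f ρ ∷ʳ z)
Jumps-lift f z m {k₀} base (start n) n≡m with trans (sym (length-upTo n)) n≡m
... | refl rewrite +-identityʳ k₀ = base
Jumps-lift f z m {k₀} base {suc k} (step {σ = σ} i j J i<j j<) len≡m rewrite +-suc k₀ k =
  subst (Jumps (suc (k₀ + k))) moved (step i j (Jumps-lift f z m base J lenσ≡m) i<j j<′)
  where
  lenσ≡m : length σ ≡ m
  lenσ≡m = trans (sym (trans (cong length (rightJump≡jump i j σ)) (length-jump i j σ))) len≡m
  j<fσ : j < length (map f σ)
  j<fσ = subst (j <_) (sym (length-map f σ)) j<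
  j<′ : j < length (map f σ ∷ʳ z)
  j<′ = subst (j <_) (sym (length-++ (map f σ))) (m≤n⇒m≤n+o 1 j<fσ)
  moved : rightJump i j (map f σ ∷ʳ z) ≡ map f (rightJump i j σ) ∷ʳ z
  moved = begin
    rightJump i j (map f σ ∷ʳ z)  ≡⟨ rightJump≡jump i j _ ⟩
    jump i j (map f σ ∷ʳ z)       ≡⟨ jump-∷ʳ i j (map f σ) z i<j j<fσ ⟩
    jump i j (map f σ) ∷ʳ z       ≡⟨ cong (_∷ʳ z) (jump-map f i j σ) ⟩
    map f (jump i j σ) ∷ʳ z       ≡⟨ cong (λ τ → map f τ ∷ʳ z) (sym (rightJump≡jump i j σ)) ⟩
    map f (rightJump i j σ) ∷ʳ z  ∎
    where open ≡-Reasoning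

-- When z is not the maximum m, the entry m before it keeps z from being a record,
-- which pays for the jump moving z to the end.
last-entry-jumps : ∀ {m} σ z → σ ∷ʳ z ↭ range 0 (suc m) →
  ∃[ k₀ ] Jumps k₀ (map (openGap z) (upTo m) ∷ʳ z) × k₀ + records 0 (σ ∷ʳ z) ≤ suc (records 0 σ)
last-entry-jumps {m} σ z perm with z ≟ m | proj₁ (standardize-deletion σ z [] perm)
... | yes refl | _ = 0 , subst (Jumps 0) identity (start (suc z)) , records-∷ʳ-≤ 0 σ z
  where
  identity : upTo (suc z) ≡ map (openGap z) (upTo z) ∷ʳ z
  identity = begin
    upTo (suc z)                     ≡⟨ sym (upTo-∷ʳ z) ⟩
    upTo z ∷ʳ z                      ≡⟨ cong (_∷ʳ z) (upTo≡range z) ⟩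
    range 0 z ∷ʳ z                   ≡⟨ cong (_∷ʳ z) (sym (map-range (openGap z) 0 0 z λ i i<z → openGap-< i<z)) ⟩
    map (openGap z) (range 0 z) ∷ʳ z ≡⟨ cong (λ τ → map (openGap z) τ ∷ʳ z) (sym (upTo≡range z)) ⟩
    map (openGap z) (upTo z) ∷ʳ z    ∎
    where open ≡-Reasoning
... | no z≢m | z≤m = 1 , subst (Jumps 1) moved (step z m (start (suc m)) (≤∧≢⇒< z≤m z≢m) m<len) ,
                      ≤-reflexive (cong suc (records-∷ʳ-dominated 0 σ m∈σ z≤m))
  where
  m<len : m < length (upTo (suc m))
  m<len = subst (m <_) (sym (length-upTo (suc m))) ≤-refl
  moved : rightJump z m (upTo (suc m)) ≡ map (openGap z) (upTo m) ∷ʳ z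
  moved = begin
    rightJump z m (upTo (suc m))        ≡⟨ rightJump≡jump z m _ ⟩
    jump z m (upTo (suc m))             ≡⟨ cong (jump z m) (upTo≡range (suc m)) ⟩
    jump z m (range 0 (suc m))          ≡⟨ jump-range 0 z m z≤m ⟩
    map (openGap z) (range 0 m) ∷ʳ z    ≡⟨ cong (λ τ → map (openGap z) τ ∷ʳ z) (sym (upTo≡range m)) ⟩
    map (openGap z) (upTo m) ∷ʳ z       ∎
    where open ≡-Reasoning
  m∈σ : m ∈ σ
  m∈σ with ∈-++⁻ σ (∈-resp-↭ (↭-sym perm) (∈-range⁺ 0 (suc m) z≤n ≤-refl))
  ... | inj₁ m∈σ       = m∈σ
  ... | inj₂ (here m≡z) = ⊥-elim (z≢m (sym m≡z))

jumps-complete : ∀ m σ → σ ↭ range 0 m → ∃[ k ] k + records 0 σ ≤ m × Jumps k σ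
jumps-complete zero    σ perm rewrite ↭-empty-inv perm = 0 , z≤n , start 0
jumps-complete (suc m) σ perm = extend (initLast σ) perm
  where
  extend : ∀ {σ} → InitLast σ → σ ↭ range 0 (suc m) → ∃[ k ] k + records 0 σ ≤ suc m × Jumps k σ
  extend []         perm = ⊥-elim (0≢1+n (↭-length perm))
  extend (σ′ ∷ʳ′ z) perm
    with _ , ρ↭ , ≢z ← standardize-deletion σ′ z [] perm
       | k₀ , base , k₀-bound ← last-entry-jumps σ′ z perm
    rewrite ++-identityʳ σ′
    with k , k-bound , J ← jumps-complete m (map (closeGap z) σ′) ρ↭
    = k₀ + k , bound , subst (λ τ → Jumps (k₀ + k) (τ ∷ʳ z)) restored lifted
    where
    ρ : List ℕ
    ρ = map (closeGap z) σ′
    lifted : Jumps (k₀ + k) (map (openGap z) ρ ∷ʳ z)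
    lifted = Jumps-lift (openGap z) z m base J (trans (↭-length ρ↭) (length-range 0 m))
    restored : map (openGap z) ρ ≡ σ′
    restored = trans (sym (map-∘ σ′)) (map-id-local (All.map openGap-closeGap ≢z))
    records-σ′≡records-ρ : records 0 σ′ ≡ records 0 ρ
    records-σ′≡records-ρ = records-map (closeGap-orderEmbedding z) σ′ ≢z
    bound : k₀ + k + records 0 (σ′ ∷ʳ z) ≤ suc m
    bound = begin
      k₀ + k + records 0 (σ′ ∷ʳ z)     ≡⟨ cong (_+ records 0 (σ′ ∷ʳ z)) (+-comm k₀ k) ⟩
      k + k₀ + records 0 (σ′ ∷ʳ z)     ≡⟨ +-assoc k k₀ _ ⟩
      k + (k₀ + records 0 (σ′ ∷ʳ z))   ≤⟨ +-monoʳ-≤ k k₀-bound ⟩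
      k + suc (records 0 σ′)           ≡⟨ +-suc k _ ⟩
      suc (k + records 0 σ′)           ≡⟨ cong (λ r → suc (k + r)) records-σ′≡records-ρ ⟩
      suc (k + records 0 ρ)            ≤⟨ s≤s k-bound ⟩
      suc m                            ∎
      where open ≤-Reasoning

IsPerm⇒↭range : ∀ {σ} → IsPerm σ → σ ↭ range 0 (length σ)
IsPerm⇒↭range {σ} = subst (σ ↭_) (upTo≡range (length σ))

↭range⇒IsPerm : ∀ {σ n} → σ ↭ range 0 n → IsPerm σ
↭range⇒IsPerm {σ} {n} σ↭ =
  subst (σ ↭_) (trans (sym (upTo≡range n)) (cong upTo (sym (trans (↭-length σ↭) (length-range 0 n))))) σ↭

InC⇒length≤ : ∀ {p σ} → InC p σ → length σ ≤ p + records 0 σ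
InC⇒length≤ (_ , k , k≤p , J) = ≤-trans (length≤jumps+records J) (+-monoˡ-≤ _ k≤p)

length≤⇒InC : ∀ {p σ} → IsPerm σ → length σ ≤ p + records 0 σ → InC p σ
length≤⇒InC {p} {σ} σ↭ len≤
  with k , k-bound , J ← jumps-complete (length σ) σ (IsPerm⇒↭range σ↭)
  = σ↭ , k , +-cancelʳ-≤ (records 0 σ) k p (≤-trans k-bound len≤) , J

cancel-2-<-double : ∀ {l r} → 2 + l < suc r + suc r → l < r + r
cancel-2-<-double {l} {r} = ≤-pred ∘ ≤-pred ∘ subst (3 + l ≤_) (cong suc (+-suc r r))

-- By pigeonhole some record is immediately followed by another; deleting it loses exactly one record.
lossy-deletion : ∀ t xs → length xs < records t xs + records t xs →
  ∃[ A ] ∃[ v ] ∃[ B ] xs ≡ A ++ v ∷ B × records t (A ++ B) < records t xs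
lossy-deletion t (x ∷ xs) dense with t ≤? x
lossy-deletion t (x ∷ []) dense | yes _ = [] , x , [] , refl , z<s
lossy-deletion t (x ∷ y ∷ xs) dense | yes t≤x with suc x ≤? y
... | yes x<y = [] , x , y ∷ xs , refl , s≤s (≤-reflexive (records-≤ xs (≤-trans t≤x (<⇒≤ x<y))))
... | no  x≮y with A , v , B , refl , loss ← lossy-deletion (suc x) xs (cancel-2-<-double dense)
  = x ∷ y ∷ A , v , B , refl ,
    subst (_< _) (sym (trans (records-≤ (y ∷ A ++ B) t≤x) (cong suc (records-> (A ++ B) (≰⇒> x≮y))))) (s≤s loss)
lossy-deletion t (x ∷ xs) dense | no t≰x
  with A , v , B , refl , loss ← lossy-deletion t xs (<-trans (n<1+n _) dense)
  = x ∷ A , v , B , refl , subst (_< _) (sym (records-> (A ++ B) (≰⇒> t≰x))) loss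

basis-deletion : ∀ {p σ} A v B → InB p σ → σ ≡ A ++ v ∷ B → length (A ++ B) ≤ p + records 0 (A ++ B)
basis-deletion {p} A v B (σ↭ , _ , patterns-in-C) refl
  with _ , π↭ , ≢v ← standardize-deletion A v B
                        (subst (λ n → A ++ v ∷ B ↭ range 0 n) (length-++-sucʳ A v B) (IsPerm⇒↭range σ↭))
  = subst₂ (λ n r → n ≤ p + r)
      (length-map (closeGap v) (A ++ B)) (sym (records-map (closeGap-orderEmbedding v) (A ++ B) ≢v))
      (InC⇒length≤ (patterns-in-C π π-pattern π≢σ))
  where
  π : List ℕ
  π = map (closeGap v) (A ++ B)
  π-pattern : Pattern π (A ++ v ∷ B)
  π-pattern = ↭range⇒IsPerm π↭
            , A ++ B , ++⁺ ⊆-refl (++⁺ˡ [ v ] ⊆-refl) , map-orderIso (closeGap-orderEmbedding v) ≢v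
  π≢σ : π ≢ A ++ v ∷ B
  π≢σ π≡σ = <-irrefl
    (trans (sym (length-map (closeGap v) (A ++ B))) (trans (cong length π≡σ) (length-++-sucʳ A v B))) ≤-refl

basis-length≤ : ∀ {p} σ → InB p σ → length σ ≤ suc (p + records 0 σ)
basis-length≤ {p} σ σ∈B with initLast σ
... | []       = z≤n
... | σ′ ∷ʳ′ z = begin
  length (σ′ ∷ʳ z)               ≡⟨ length-++-sucʳ σ′ z [] ⟩
  suc (length (σ′ ++ []))        ≤⟨ s≤s (basis-deletion σ′ z [] σ∈B refl) ⟩
  suc (p + records 0 (σ′ ++ [])) ≡⟨ cong (λ τ → suc (p + records 0 τ)) (++-identityʳ σ′) ⟩
  suc (p + records 0 σ′)         ≤⟨ s≤s (+-monoʳ-≤ p (records-++-≤ 0 σ′ [ z ])) ⟩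
  suc (p + records 0 (σ′ ∷ʳ z))  ∎
  where open ≤-Reasoning

basis-no-lossy-deletion : ∀ {p σ} A v B → InB p σ → σ ≡ A ++ v ∷ B →
  ¬ (records 0 (A ++ B) < records 0 σ)
basis-no-lossy-deletion {p} A v B σ∈B@(σ↭ , σ∉C , _) refl loss = σ∉C (length≤⇒InC σ↭ (begin
  length (A ++ v ∷ B)          ≡⟨ length-++-sucʳ A v B ⟩
  suc (length (A ++ B))        ≤⟨ s≤s (basis-deletion A v B σ∈B refl) ⟩
  suc (p + records 0 (A ++ B)) ≡⟨ sym (+-suc p _) ⟩
  p + suc (records 0 (A ++ B)) ≤⟨ +-monoʳ-≤ p loss ⟩
  p + records 0 (A ++ v ∷ B)   ∎))
  where open ≤-Reasoning

basis-length : ∀ {p σ} → InB p σ → length σ ≡ suc (p + records 0 σ)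
basis-length {σ = σ} σ∈B@(σ↭ , σ∉C , _) = ≤-antisym (basis-length≤ σ σ∈B) (≰⇒> (σ∉C ∘ length≤⇒InC σ↭))

basis-records-sparse : ∀ {p σ} → InB p σ → records 0 σ + records 0 σ ≤ length σ
basis-records-sparse {σ = σ} σ∈B = ≮⇒≥ λ dense →
  let A , v , B , σ≡ , loss = lossy-deletion 0 σ dense
  in basis-no-lossy-deletion A v B σ∈B σ≡ loss

length-bounds : ∀ {n p r} → n ≡ suc (p + r) → r + r ≤ n → 0 < r → n ≤ 2 * (p + 1) × p + 2 ≤ n
length-bounds {p = p} {r} refl sparse r>0 = upper , lower
  where
  upper : suc p + r ≤ 2 * (p + 1)
  upper = subst (suc p + r ≤_) double (+-monoʳ-≤ (suc p) (+-cancelʳ-≤ r r (suc p) sparse))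
    where
    double : suc p + suc p ≡ 2 * (p + 1)
    double = sym (cong₂ _+_ (+-comm p 1) (trans (+-identityʳ (p + 1)) (+-comm p 1)))
  lower : p + 2 ≤ suc (p + r)
  lower = subst (_≤ suc (p + r)) (sym (+-suc p 1)) (s≤s (+-monoʳ-≤ p r>0))

corollary2 : (p : ℕ) (σ : List ℕ) → InB p σ →
    (length σ ≤ 2 * (p + 1)) × (p + 2 ≤ length σ)
corollary2 p σ σ∈B =
  length-bounds len (basis-records-sparse σ∈B) (records-pos σ (subst (0 <_) (sym len) z<s))
  where
  len : length σ ≡ suc (p + records 0 σ)
  len = basis-length σ∈B
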